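{- Let $b\in\mathbb N$, $b\ge2$. Then there exists $m\in\mathbb N$ such that $m$ is antipalindromic in base $b$ and also antipalindromic in at least one other base $c\neq b$ with $c<m$.
   Context: For $b\in\mathbb N$, $b\ge2$, write a natural number $x$ in base $b$ as $x=a_tb^t+\dots+a_1b+a_0$ with digits $a_i\in\{0,1,\dots,b-1\}$ and $a_t\neq 0$. The number $x$ is called antipalindromic in base $b$ if $a_j=b-1-a_{t-j}$ for all $j\in\{0,1,\dots,t\}$. -}

module Defs where

open import Data.Nat using (ℕ; zero; suc; _+_; _*_; _∸_; _^_; _≤_; _<_)
open import Data.Nat.DivMod using (_/_; _%_)
open import Data.Nat.Properties using (m^n≢0)
open import Data.Product using (Σ; _×_)
open import Relation.Binary.PropositionalEquality using (_≡_)

-- the j-th base-b digit of x (least significant digit is j = 0),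
-- i.e. a_j in x = a_t b^t + ... + a_1 b + a_0.
-- Base 0 is meaningless; it is given a dummy value 0 (only bases ≥ 2 are used).
digit : (b x j : ℕ) → ℕ
digit zero    x j = 0
digit (suc c) x j = (_/_ x (suc c ^ j) {{m^n≢0 (suc c) j}}) % suc c

Antipalindromic : (b x : ℕ) → Set
Antipalindromic b x =
  Σ ℕ λ t → (b ^ t ≤ x) × (x < b ^ suc t) ×
    ((j : ℕ) → j ≤ t → digit b x j ≡ (b ∸ 1) ∸ digit b x (t ∸ j))

-- A two-digit number q·B + r with q ≥ 1 and q + r = B − 1 is antipalindromic in
-- base B.  For b ≥ 3 the number (b − 1)·b has the digits (b − 1, 0) in base b,
-- and since (b − 1)·b = (b − 2)·(b + 1) + 2 it has the digits (b − 2, 2) in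
-- base b + 1.  For b = 2 take 12 = 1100₂ = 30₄.
module Submission where

open import Defs
open import Data.Nat using (ℕ; zero; suc; _+_; _*_; _∸_; _^_; _≤_; _<_; z≤n; s≤s)
open import Data.Nat.Properties
open import Data.Nat.DivMod
open import Data.Nat.Divisibility using (divides-refl)
open import Data.Nat.Tactic.RingSolver using (solve-∀)
open import Data.Product using (Σ; _×_; _,_)
open import Relation.Nullary using (¬_)
open import Relation.Binary.PropositionalEquality
  using (_≡_; refl; sym; trans; cong; cong₂; subst; module ≡-Reasoning)

module TwoDigit {n q r : ℕ} (q<b : q < suc n) (r<b : r < suc n) where

  private
    b = suc n

  digit-zero : digit b (r + q * b) 0 ≡ r
  digit-zero = begin
    (r + q * b) / 1 % b  ≡⟨ cong (_% b) (n/1≡n (r + q * b)) ⟩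
    (r + q * b) % b      ≡⟨ [m+kn]%n≡m%n r q b ⟩
    r % b                ≡⟨ m<n⇒m%n≡m r<b ⟩
    r                    ∎
    where open ≡-Reasoning

  digit-one : digit b (r + q * b) 1 ≡ q
  digit-one = begin
    (r + q * b) / (b * 1) % b    ≡⟨ cong (_% b) (/-congʳ {m = r + q * b} (*-identityʳ b)) ⟩
    (r + q * b) / b % b          ≡⟨ cong (_% b) (+-distrib-/-∣ʳ r (divides-refl q)) ⟩
    (r / b + q * b / b) % b      ≡⟨ cong (_% b) (cong₂ _+_ (m<n⇒m/n≡0 r<b) (m*n/n≡m q b)) ⟩
    q % b                        ≡⟨ m<n⇒m%n≡m q<b ⟩
    q                            ∎
    where open ≡-Reasoning

  base≤twoDigit : 1 ≤ q → b ^ 1 ≤ r + q * b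
  base≤twoDigit 1≤q = begin
    b * 1      ≡⟨ *-comm b 1 ⟩
    1 * b      ≤⟨ *-monoˡ-≤ b 1≤q ⟩
    q * b      ≤⟨ m≤n+m (q * b) r ⟩
    r + q * b  ∎
    where open ≤-Reasoning

  twoDigit<base² : r + q * b < b ^ 2
  twoDigit<base² = begin-strict
    r + q * b  <⟨ +-monoˡ-< (q * b) r<b ⟩
    b + q * b  ≡⟨⟩
    suc q * b  ≤⟨ *-monoˡ-≤ b q<b ⟩
    b * b      ≡⟨ cong (b *_) (sym (*-identityʳ b)) ⟩
    b ^ 2      ∎
    where open ≤-Reasoning

twoDigit-antipalindromic : ∀ n q r → 1 ≤ q → q + r ≡ n →
  Antipalindromic (suc n) (r + q * suc n)
twoDigit-antipalindromic n q r 1≤q q+r≡n =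
  1 , base≤twoDigit 1≤q , twoDigit<base² , digits-complementary
  where
  q≤n : q ≤ n
  q≤n = subst (q ≤_) q+r≡n (m≤m+n q r)
  r≤n : r ≤ n
  r≤n = subst (r ≤_) q+r≡n (m≤n+m r q)
  open TwoDigit (s≤s q≤n) (s≤s r≤n)
  r≡n∸q : r ≡ n ∸ q
  r≡n∸q = trans (sym (m+n∸m≡n q r)) (cong (_∸ q) q+r≡n)
  q≡n∸r : q ≡ n ∸ r
  q≡n∸r = trans (sym (m+n∸n≡m q r)) (cong (_∸ r) q+r≡n)
  digits-complementary : ∀ j → j ≤ 1 →
    digit (suc n) (r + q * suc n) j ≡ n ∸ digit (suc n) (r + q * suc n) (1 ∸ j)
  digits-complementary 0 _ = trans digit-zero (trans r≡n∸q (cong (n ∸_) (sym digit-one)))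
  digits-complementary 1 _ = trans digit-one (trans q≡n∸r (cong (n ∸_) (sym digit-zero)))
  digits-complementary (suc (suc j)) (s≤s ())

base<twoDigit : ∀ {b q r} → 1 ≤ q → 1 ≤ r → b < r + q * b
base<twoDigit {b} {suc q} {suc r} _ _ = s≤s (m≤n⇒m≤o+n r (m≤m+n b (q * b)))

pronic-in-next-base : ∀ k → (2 + k) * (3 + k) ≡ 2 + (1 + k) * (4 + k)
pronic-in-next-base = solve-∀

twelve-antipalindromic₂ : Antipalindromic 2 12
twelve-antipalindromic₂ = 3 , 8≤12 , 12<16 , digits-complementary
  where
  8≤12 : 8 ≤ 12
  8≤12 = m≤m+n 8 4
  12<16 : 12 < 16
  12<16 = m≤m+n 13 3
  digits-complementary : ∀ j → j ≤ 3 → digit 2 12 j ≡ 1 ∸ digit 2 12 (3 ∸ j)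
  digits-complementary 0 _ = refl
  digits-complementary 1 _ = refl
  digits-complementary 2 _ = refl
  digits-complementary 3 _ = refl
  digits-complementary (suc (suc (suc (suc j)))) (s≤s (s≤s (s≤s ())))

mainTheorem15 : (b : ℕ) → 2 ≤ b →
    Σ ℕ λ m → Antipalindromic b m ×
    Σ ℕ λ c → 2 ≤ c × ¬ (c ≡ b) × c < m × Antipalindromic c m
mainTheorem15 (suc zero) (s≤s ())
mainTheorem15 (suc (suc zero)) _ =
  12 , twelve-antipalindromic₂ ,
  4 , m≤m+n 2 2 , (λ ()) , m≤m+n 5 7 ,
  twoDigit-antipalindromic 3 3 0 (s≤s z≤n) refl
mainTheorem15 (suc (suc (suc k))) _ =
  (2 + k) * (3 + k) ,
  twoDigit-antipalindromic (2 + k) (2 + k) 0 (s≤s z≤n) (+-identityʳ (2 + k)) ,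
  4 + k , s≤s (s≤s z≤n) , 1+n≢n ,
  subst (4 + k <_) (sym (pronic-in-next-base k)) (base<twoDigit {q = 1 + k} {r = 2} (s≤s z≤n) (s≤s z≤n)) ,
  subst (Antipalindromic (4 + k)) (sym (pronic-in-next-base k))
    (twoDigit-antipalindromic (3 + k) (1 + k) 2 (s≤s z≤n) (cong suc (+-comm k 2)))
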